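{- For every positive integer $m$, there exists an $m$-uniform shift-chain $\mathcal{H} = ([n], \mathcal{E})$ that has no polychromatic $3$-coloring; that is, for every map $c : [n] \to \{1,2,3\}$ there is an edge $A \in \mathcal{E}$ such that $\{c(a) : a \in A\} \neq \{1,2,3\}$.
   Context: An ordered $m$-uniform hypergraph $\mathcal{H} = (V, \mathcal{E})$ has vertex set $V = [n] = \{1,\ldots,n\}$ for some positive integer $n$ and edge set $\mathcal{E} \subseteq V^m$, where every edge $A = (a_1,\ldots,a_m) \in \mathcal{E}$ satisfies $a_1 < a_2 < \cdots < a_m$. Two edges $A = (a_1,\ldots,a_m)$ and $B = (b_1,\ldots,b_m)$ are comparable if $a_i \le b_i$ for all $i \in [m]$ or $b_i \le a_i$ for all $i \in [m]$. An ordered $m$-uniform hypergraph is an $m$-uniform shift-chain if any two of its edges are comparable. A polychromatic $3$-coloring of a hypergraph is a coloring of its vertices with three colors such that every edge contains vertices of all three colors. -}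

module Defs where

open import Data.Nat using (ℕ; suc)
open import Data.Fin using (Fin; _<_; _≤_)
open import Data.List using (List)
open import Data.List.Membership.Propositional using (_∈_)
open import Data.Product using (∃; _×_)
open import Data.Sum using (_⊎_)
open import Relation.Binary.PropositionalEquality using (_≡_)

-- The vertex set [n] = {1,…,n} is represented by Fin n = {0,…,n-1}
-- (order-preserving relabelling i ↦ i-1).

Tuple : ℕ → ℕ → Set
Tuple m n = Fin m → Fin n

StrictlyIncreasing : ∀ {m n} → Tuple m n → Set
StrictlyIncreasing {m} A = ∀ (i j : Fin m) → i < j → A i < A j

record OrderedHypergraph (m n : ℕ) : Set where
  field
    edges      : List (Tuple m n)
    increasing : ∀ A → A ∈ edges → StrictlyIncreasing A
open OrderedHypergraph public

Below : ∀ {m n} → Tuple m n → Tuple m n → Set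
Below {m} A B = ∀ (i : Fin m) → A i ≤ B i

Comparable : ∀ {m n} → Tuple m n → Tuple m n → Set
Comparable A B = Below A B ⊎ Below B A

IsShiftChain : ∀ {m n} → OrderedHypergraph m n → Set
IsShiftChain H = ∀ A B → A ∈ edges H → B ∈ edges H → Comparable A B

Coloring : ℕ → Set
Coloring n = Fin n → Fin 3

Rainbow : ∀ {m n} → Coloring n → Tuple m n → Set
Rainbow {m} c A = ∀ (k : Fin 3) → ∃ λ (i : Fin m) → c (A i) ≡ k

IsPolychromatic3 : ∀ {m n} → OrderedHypergraph m n → Coloring n → Set
IsPolychromatic3 H c = ∀ A → A ∈ edges H → Rainbow c A

{-# OPTIONS --safe #-}
module Submission where

open import Defs
open import Data.Nat using (ℕ; _≥_)
open import Data.List.Membership.Propositional using (_∈_)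
open import Data.Product using (∃; ∃₂; _×_)
open import Relation.Nullary using (¬_)

open import Level using (Level)
open import Function using (_∘_)
open import Data.Nat using (zero; suc; _+_; _*_; _≤_; _<_; z≤n; s<s⁻¹; NonZero)
open import Data.Nat.Properties
  using (≤-refl; ≤-trans; <⇒≤; <-≤-trans; m≤m+n; +-monoʳ-≤; +-monoʳ-<; +-monoˡ-≤; +-assoc)
open import Data.Nat.DivMod using (_mod_; m<n⇒m%n≡m)
open import Data.Fin as Fin using (Fin; toℕ)
open import Data.Fin.Patterns using (0F; 1F; 2F)
open import Data.Fin.Properties
  using (toℕ<n; toℕ-fromℕ<; all?; ¬∀⟶∃¬) renaming (_≟_ to _≟ᶠ_)
open import Data.List using (List; []; _∷_; _++_; map; concatMap; tabulate; length)
open import Data.List.Relation.Unary.All as All using (All; []; _∷_)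
import Data.List.Relation.Unary.All.Properties as All
open import Data.List.Relation.Unary.AllPairs as AllPairs using (AllPairs; []; _∷_)
import Data.List.Relation.Unary.AllPairs.Properties as AllPairs
open import Data.List.Relation.Unary.Any using (here; there)
open import Data.List.Membership.Propositional.Properties
  using (∈-map⁺; ∈-map⁻; ∈-++⁺ˡ; ∈-++⁺ʳ; ∈-++⁻; ∈-tabulate⁺; ∈-tabulate⁻; ∈-concat⁺′; ∈-concat⁻′)
open import Data.Vec.Functional using (Vector) renaming ([] to []ᵛ; _∷_ to _◂_)
open import Data.Vec.Functional.Relation.Binary.Pointwise using (Pointwise)
open import Data.Product using (_,_; proj₁; proj₂)
open import Data.Sum as Sum using (_⊎_; inj₁; inj₂)
open import Relation.Binary using (Rel; Reflexive; _Preserves_⟶_)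
open import Relation.Binary.PropositionalEquality
  using (_≡_; _≢_; refl; sym; trans; subst; subst₂)
open import Relation.Nullary using (yes; no)

-- The shift-chains are built by induction on the uniformity. Let L be a shift-chain of
-- k-edges such that every 3-colouring leaves some edge without some colour. Take a vertex 0,
-- then one block B_E of k fresh vertices for each edge E of L, then a copy S + L of L shifted
-- past all blocks. The new (k+1)-edges are {0} ∪ B_E, and {b} ∪ (S + E) for b ∈ B_E.
-- Given a colouring, some S + E misses a colour x. If all of B_E has colour x, then
-- {0} ∪ B_E sees at most two colours; otherwise some b ∈ B_E is not coloured x, and
-- {b} ∪ (S + E) misses x. Listing first the edges {0} ∪ B_E and then the edges
-- {b} ∪ (S + E), both in the order of E (and then of b), gives a chain for the
-- componentwise order, because the blocks are laid out in the order of L.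

private
  variable
    a r : Level
    A : Set a
    k n o : ℕ

allPairs⇒comparable : {R : Rel A r} → Reflexive R → {xs : List A} → AllPairs R xs →
                      ∀ {x y} → x ∈ xs → y ∈ xs → R x y ⊎ R y x
allPairs⇒comparable R-refl (_  ∷ _)   (here refl) (here refl) = inj₁ R-refl
allPairs⇒comparable R-refl (Rx ∷ _)   (here refl) (there y∈)  = inj₁ (All.lookup Rx y∈)
allPairs⇒comparable R-refl (Rx ∷ _)   (there x∈)  (here refl) = inj₂ (All.lookup Rx x∈)
allPairs⇒comparable R-refl (_  ∷ Rxs) (there x∈)  (there y∈)  =
  allPairs⇒comparable R-refl Rxs x∈ y∈

withOffsets : ℕ → ℕ → List A → List (ℕ × A)
withOffsets k o []       = []
withOffsets k o (x ∷ xs) = (o , x) ∷ withOffsets k (o + k) xs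

∈-withOffsets⁻ : ∀ {o′} {x : A} xs → (o′ , x) ∈ withOffsets k o xs →
                 x ∈ xs × o ≤ o′ × o′ + k ≤ o + length xs * k
∈-withOffsets⁻ {k = k} {o} (_ ∷ xs) (here refl) =
  here refl , ≤-refl , +-monoʳ-≤ o (m≤m+n k (length xs * k))
∈-withOffsets⁻ {k = k} {o} {o′} (_ ∷ xs) (there p) =
  let x∈xs , o+k≤o′ , o′+k≤end = ∈-withOffsets⁻ xs p
  in  there x∈xs , ≤-trans (m≤m+n o k) o+k≤o′ ,
      subst (o′ + k ≤_) (+-assoc o k (length xs * k)) o′+k≤end

∈-withOffsets⁺ : {x : A} {xs : List A} → x ∈ xs → ∃ λ o′ → (o′ , x) ∈ withOffsets k o xs
∈-withOffsets⁺ (here refl)  = _ , here refl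
∈-withOffsets⁺ (there x∈xs) = let o′ , p = ∈-withOffsets⁺ x∈xs in o′ , there p

Precedes : ℕ → Rel A r → Rel (ℕ × A) r
Precedes k R (o , x) (o′ , y) = o + k ≤ o′ × R x y

withOffsets-allPairs : {R : Rel A r} {xs : List A} → AllPairs R xs →
                       AllPairs (Precedes k R) (withOffsets k o xs)
withOffsets-allPairs [] = []
withOffsets-allPairs {k = k} {o} {R = R} {x ∷ xs} (Rx ∷ Rxs) =
  All.tabulate later ∷ withOffsets-allPairs Rxs
  where
  later : ∀ {p} → p ∈ withOffsets k (o + k) xs → Precedes k R (o , x) p
  later p∈ = let y∈xs , o+k≤o′ , _ = ∈-withOffsets⁻ xs p∈ in o+k≤o′ , All.lookup Rx y∈xs

_≤ᵛ_ : Rel (Vector ℕ k) _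
_≤ᵛ_ = Pointwise _≤_

IsIncreasingBelow : ℕ → Vector ℕ k → Set
IsIncreasingBelow n A = (∀ i → A i < n) × A Preserves Fin._<_ ⟶ _<_

blockEdge : ℕ → Vector ℕ (suc k)
blockEdge o = 0 ◂ λ i → o + toℕ i

liftEdge : ℕ → ℕ → Vector ℕ k → Vector ℕ (suc k)
liftEdge S b E = b ◂ λ i → S + E i

blockEdge-mono : ∀ {o o′} → o ≤ o′ → blockEdge {k} o ≤ᵛ blockEdge o′
blockEdge-mono o≤o′ 0F          = z≤n
blockEdge-mono o≤o′ (Fin.suc i) = +-monoˡ-≤ (toℕ i) o≤o′

liftEdge-mono : ∀ {S b b′} {E E′ : Vector ℕ k} → b ≤ b′ → E ≤ᵛ E′ →
                liftEdge S b E ≤ᵛ liftEdge S b′ E′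
liftEdge-mono         b≤b′ E≤E′ 0F          = b≤b′
liftEdge-mono {S = S} b≤b′ E≤E′ (Fin.suc i) = +-monoʳ-≤ S (E≤E′ i)

blockEdge≤liftEdge : ∀ {S b} {E : Vector ℕ k} → o + k ≤ S → blockEdge o ≤ᵛ liftEdge S b E
blockEdge≤liftEdge o+k≤S 0F = z≤n
blockEdge≤liftEdge {o = o} {S = S} {E = E} o+k≤S (Fin.suc i) =
  ≤-trans (<⇒≤ (+-monoʳ-< o (toℕ<n i))) (≤-trans o+k≤S (m≤m+n S (E i)))

blockEdge-increasingBelow : 1 ≤ o → o + k ≤ n → IsIncreasingBelow n (blockEdge {k} o)
blockEdge-increasingBelow {o = o} {k = k} 1≤o o+k≤n = bounded , ascending
  where
  bounded : ∀ i → blockEdge {k} o i < _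
  bounded 0F          = <-≤-trans 1≤o (≤-trans (m≤m+n o k) o+k≤n)
  bounded (Fin.suc i) = <-≤-trans (+-monoʳ-< o (toℕ<n i)) o+k≤n
  ascending : blockEdge {k} o Preserves Fin._<_ ⟶ _<_
  ascending {0F}        {Fin.suc j} _   = <-≤-trans 1≤o (m≤m+n o (toℕ j))
  ascending {Fin.suc i} {Fin.suc j} i<j = +-monoʳ-< o (s<s⁻¹ i<j)

liftEdge-increasingBelow : ∀ {S b} {E : Vector ℕ k} → b < S → IsIncreasingBelow n E →
                           IsIncreasingBelow (S + n) (liftEdge S b E)
liftEdge-increasingBelow {n = n} {S} {b} {E} b<S (E<n , E-ascending) = bounded , ascending
  where
  bounded : ∀ i → liftEdge S b E i < S + n
  bounded 0F          = <-≤-trans b<S (m≤m+n S n)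
  bounded (Fin.suc i) = +-monoʳ-< S (E<n i)
  ascending : liftEdge S b E Preserves Fin._<_ ⟶ _<_
  ascending {0F}        {Fin.suc j} _   = <-≤-trans b<S (m≤m+n S (E j))
  ascending {Fin.suc i} {Fin.suc j} i<j = +-monoʳ-< S (E-ascending (s<s⁻¹ i<j))

copyStart : List (Vector ℕ k) → ℕ
copyStart {k} L = suc (length L * k)

blocks : List (Vector ℕ k) → List (ℕ × Vector ℕ k)
blocks {k} = withOffsets k 1

blockEdges : List (ℕ × Vector ℕ k) → List (Vector ℕ (suc k))
blockEdges = map (blockEdge ∘ proj₁)

liftEdges : ℕ → ℕ × Vector ℕ k → List (Vector ℕ (suc k))
liftEdges {k} S (o , E) = tabulate λ (j : Fin k) → liftEdge S (o + toℕ j) E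

next : List (Vector ℕ k) → List (Vector ℕ (suc k))
next L = blockEdges (blocks L) ++ concatMap (liftEdges (copyStart L)) (blocks L)

∈-blockEdges⁻ : ∀ {L : List (Vector ℕ k)} {A} → A ∈ blockEdges (blocks L) →
                ∃ λ o → A ≡ blockEdge o × 1 ≤ o × o + k ≤ copyStart L
∈-blockEdges⁻ {L = L} A∈ with ∈-map⁻ (blockEdge ∘ proj₁) A∈
... | (o , E) , oE∈ , refl =
  let _ , 1≤o , o+k≤S = ∈-withOffsets⁻ L oE∈ in o , refl , 1≤o , o+k≤S

∈-liftEdges⁻ : ∀ {S} {L : List (Vector ℕ k)} {A} → A ∈ concatMap (liftEdges S) (blocks L) →
               ∃₂ λ b E → A ≡ liftEdge S b E × b < copyStart L × E ∈ L
∈-liftEdges⁻ {k = k} {S} {L} A∈ with ∈-concat⁻′ (map (liftEdges S) (blocks L)) A∈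
... | row , A∈row , row∈ with ∈-map⁻ (liftEdges S) row∈
... | (o , E) , oE∈ , refl with ∈-tabulate⁻ {f = λ (j : Fin k) → liftEdge S (o + toℕ j) E} A∈row
... | j , A≡ =
  let E∈L , _ , o+k≤S = ∈-withOffsets⁻ L oE∈
  in  o + toℕ j , E , A≡ , <-≤-trans (+-monoʳ-< o (toℕ<n j)) o+k≤S , E∈L

next-increasingBelow : {L : List (Vector ℕ k)} → (∀ {E} → E ∈ L → IsIncreasingBelow n E) →
                       ∀ {A} → A ∈ next L → IsIncreasingBelow (copyStart L + n) A
next-increasingBelow {n = n} {L} L-fits A∈ with ∈-++⁻ (blockEdges (blocks L)) A∈
... | inj₁ A∈blockEdges with ∈-blockEdges⁻ A∈blockEdges
...   | o , refl , 1≤o , o+k≤S = blockEdge-increasingBelow 1≤o (≤-trans o+k≤S (m≤m+n _ n))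
next-increasingBelow {L = L} L-fits A∈ | inj₂ A∈liftEdges with ∈-liftEdges⁻ {L = L} A∈liftEdges
...   | b , E , refl , b<S , E∈L = liftEdge-increasingBelow b<S (L-fits E∈L)

next-chain : {L : List (Vector ℕ k)} → AllPairs _≤ᵛ_ L → AllPairs _≤ᵛ_ (next L)
next-chain {k} {L} L-chain =
  AllPairs.++⁺ blockEdges-chain liftEdges-chain (All.tabulate blockEdge≤liftEdges)
  where
  S = copyStart L

  offsets-chain : AllPairs (Precedes k _≤ᵛ_) (blocks L)
  offsets-chain = withOffsets-allPairs L-chain

  blockEdges-chain : AllPairs _≤ᵛ_ (blockEdges (blocks L))
  blockEdges-chain = AllPairs.map⁺ (AllPairs.map
    (λ { {o , _} (o+k≤o′ , _) → blockEdge-mono (≤-trans (m≤m+n o k) o+k≤o′) }) offsets-chain)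

  row-chain : ∀ p → AllPairs _≤ᵛ_ (liftEdges S p)
  row-chain (o , E) = AllPairs.tabulate⁺-< λ i<j →
    liftEdge-mono {S = S} (+-monoʳ-≤ o (<⇒≤ i<j)) (λ _ → ≤-refl)

  rows-ordered : ∀ {p q} → Precedes k _≤ᵛ_ p q →
                 All (λ A → All (A ≤ᵛ_) (liftEdges S q)) (liftEdges S p)
  rows-ordered {o , _} {o′ , _} (o+k≤o′ , E≤E′) = All.tabulate⁺ λ i → All.tabulate⁺ λ j →
    liftEdge-mono {S = S}
      (≤-trans (<⇒≤ (+-monoʳ-< o (toℕ<n i))) (≤-trans o+k≤o′ (m≤m+n o′ (toℕ j)))) E≤E′

  liftEdges-chain : AllPairs _≤ᵛ_ (concatMap (liftEdges S) (blocks L))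
  liftEdges-chain = AllPairs.concat⁺ (All.map⁺ (All.universal row-chain _))
                                     (AllPairs.map⁺ (AllPairs.map rows-ordered offsets-chain))

  blockEdge≤liftEdges : ∀ {A} → A ∈ blockEdges (blocks L) →
                        All (A ≤ᵛ_) (concatMap (liftEdges S) (blocks L))
  blockEdge≤liftEdges A∈ with ∈-blockEdges⁻ A∈
  ... | o , refl , _ , o+k≤S = All.tabulate λ B∈ →
    let _ , _ , B≡ , _ = ∈-liftEdges⁻ {L = L} B∈
    in  subst (blockEdge o ≤ᵛ_) (sym B≡) (blockEdge≤liftEdge o+k≤S)

Avoids : (ℕ → Fin 3) → Fin 3 → Vector ℕ k → Set
Avoids c x A = ∀ i → c (A i) ≢ x

-- Colourings are of all of ℕ, so that restricting one to the shifted copy S + L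
-- is precomposition with (S +_).
Unavoidable : List (Vector ℕ k) → Set
Unavoidable L = ∀ c → ∃₂ λ x A → A ∈ L × Avoids c x A

otherColour : (x y : Fin 3) → ∃ λ z → z ≢ x × z ≢ y
otherColour 0F 0F = 1F , (λ ()) , (λ ())
otherColour 0F 1F = 2F , (λ ()) , (λ ())
otherColour 0F 2F = 1F , (λ ()) , (λ ())
otherColour 1F 0F = 2F , (λ ()) , (λ ())
otherColour 1F 1F = 0F , (λ ()) , (λ ())
otherColour 1F 2F = 0F , (λ ()) , (λ ())
otherColour 2F 0F = 1F , (λ ()) , (λ ())
otherColour 2F 1F = 0F , (λ ()) , (λ ())
otherColour 2F 2F = 0F , (λ ()) , (λ ())

blockEdge-avoids : ∀ {c x y} → (∀ j → c (o + toℕ j) ≡ x) → y ≢ c 0 → y ≢ x →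
                   Avoids c y (blockEdge {k} o)
blockEdge-avoids block≡x y≢c0 y≢x 0F             = y≢c0 ∘ sym
blockEdge-avoids block≡x y≢c0 y≢x (Fin.suc i) eq = y≢x (trans (sym eq) (block≡x i))

liftEdge-avoids : ∀ {c x S b} {E : Vector ℕ k} → c b ≢ x → Avoids (c ∘ (S +_)) x E →
                  Avoids c x (liftEdge S b E)
liftEdge-avoids cb≢x E-avoids 0F          = cb≢x
liftEdge-avoids cb≢x E-avoids (Fin.suc i) = E-avoids i

next-unavoidable : {L : List (Vector ℕ k)} → Unavoidable L → Unavoidable (next L)
next-unavoidable {k} {L} L-unavoidable c with L-unavoidable (c ∘ (copyStart L +_))
... | x , E , E∈L , E-avoids with ∈-withOffsets⁺ {k = k} {o = 1} E∈L
... | o , oE∈ with all? (λ (j : Fin k) → c (o + toℕ j) ≟ᶠ x)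
... | yes block≡x =
  let y , y≢c0 , y≢x = otherColour (c 0) x
      block∈         = ∈-++⁺ˡ (∈-map⁺ (blockEdge ∘ proj₁) oE∈)
  in  y , blockEdge o , block∈ , blockEdge-avoids {c = c} block≡x y≢c0 y≢x
... | no block≢x =
  let j , cj≢x = ¬∀⟶∃¬ k _ (λ j → c (o + toℕ j) ≟ᶠ x) block≢x
      lift∈    = ∈-++⁺ʳ (blockEdges (blocks L))
                   (∈-concat⁺′ (∈-tabulate⁺ j) (∈-map⁺ (liftEdges (copyStart L)) oE∈))
  in  x , _ , lift∈ , liftEdge-avoids {c = c} {S = copyStart L} cj≢x E-avoids

level : ∀ k → List (Vector ℕ k)
level zero    = []ᵛ ∷ []
level (suc k) = next (level k)

size : ℕ → ℕ
size zero    = 0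
size (suc k) = copyStart (level k) + size k

level-increasingBelow : ∀ k {A} → A ∈ level k → IsIncreasingBelow (size k) A
level-increasingBelow zero    (here refl) = (λ ()) , λ { {()} }
level-increasingBelow (suc k) = next-increasingBelow (level-increasingBelow k)

level-chain : ∀ k → AllPairs _≤ᵛ_ (level k)
level-chain zero    = [] ∷ []
level-chain (suc k) = next-chain (level-chain k)

level-unavoidable : ∀ k → Unavoidable (level k)
level-unavoidable zero    c = 0F , []ᵛ , here refl , λ ()
level-unavoidable (suc k)   = next-unavoidable (level-unavoidable k)

-- `mod n` is just a total conversion ℕ → Fin n; on the labels of L, all below n,
-- it is the identity.
module Realise {m n : ℕ} .{{_ : NonZero n}} (L : List (Vector ℕ m))
               (fits : ∀ {A} → A ∈ L → IsIncreasingBelow n A) where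

  toTuple : Vector ℕ m → Tuple m n
  toTuple A i = A i mod n

  toℕ-toTuple : ∀ {A} → A ∈ L → ∀ i → toℕ (toTuple A i) ≡ A i
  toℕ-toTuple A∈L i = trans (toℕ-fromℕ< _) (m<n⇒m%n≡m (proj₁ (fits A∈L) i))

  toTuple-increasing : ∀ A → A ∈ map toTuple L → StrictlyIncreasing A
  toTuple-increasing _ A∈ with ∈-map⁻ toTuple A∈
  ... | A , A∈L , refl = λ i j i<j →
    subst₂ _<_ (sym (toℕ-toTuple A∈L i)) (sym (toℕ-toTuple A∈L j)) (proj₂ (fits A∈L) i<j)

  hypergraph : OrderedHypergraph m n
  hypergraph = record { edges = map toTuple L ; increasing = toTuple-increasing }

  toTuple-mono : ∀ {A B} → A ∈ L → B ∈ L → A ≤ᵛ B → Below (toTuple A) (toTuple B)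
  toTuple-mono A∈L B∈L A≤B i =
    subst₂ _≤_ (sym (toℕ-toTuple A∈L i)) (sym (toℕ-toTuple B∈L i)) (A≤B i)

  isShiftChain : AllPairs _≤ᵛ_ L → IsShiftChain hypergraph
  isShiftChain L-chain _ _ A∈ B∈ with ∈-map⁻ toTuple A∈ | ∈-map⁻ toTuple B∈
  ... | A , A∈L , refl | B , B∈L , refl =
    Sum.map (toTuple-mono A∈L B∈L) (toTuple-mono B∈L A∈L)
            (allPairs⇒comparable (λ _ → ≤-refl) L-chain A∈L B∈L)

  notPolychromatic : Unavoidable L → ∀ c → ∃ λ A → A ∈ edges hypergraph × ¬ Rainbow c A
  notPolychromatic L-unavoidable c =
    let x , A , A∈L , A-avoids = L-unavoidable (c ∘ (_mod n))
    in  toTuple A , ∈-map⁺ toTuple A∈L , λ rainbow → let i , cAi≡x = rainbow x in A-avoids i cAi≡x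

theorem1 : ∀ (m : ℕ) → m ≥ 1 →
    ∃₂ λ (n : ℕ) (H : OrderedHypergraph m n) →
      IsShiftChain H ×
      (∀ (c : Coloring n) → ∃ λ A → A ∈ edges H × ¬ Rainbow c A)
theorem1 (suc k) _ =
  size (suc k) , hypergraph , isShiftChain (level-chain (suc k)) ,
  notPolychromatic (level-unavoidable (suc k))
  where open Realise (level (suc k)) (level-increasingBelow (suc k))
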